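{- Let the integer matrices $(a(i,j))_{i,j\ge1}$ and $(b(i,j))_{i,j\ge1}$ be defined as follows (all entries not specified, and all entries with an index $\le 0$, are $0$). For $1\le i\le 3$ the nonzero entries are: $(a(1,1),a(1,2),a(1,3))=(10,-36,27)$; $(a(2,1),\dots,a(2,6))=(-8,306,-2160,5508,-5832,2187)$; $(a(3,1),\dots,a(3,9))=(1,-360,10566,-99144,423549,-944784,1141614,-708588,177147)$; $(b(1,1),\dots,b(1,4))=(-9,252,-891,729)$; $(b(2,1),\dots,b(2,7))=(1,-378,8613,-54675,138510,-150903,59049)$; $(b(3,1),\dots,b(3,10))=(0,147,-14553,312255,-2617839,10764414,-23914845,29288304,-18600435,4782969)$. For $i\ge4$, both $m=a$ and $m=b$ satisfy $m(i,j)=30m(i-1,j-1)-108m(i-1,j-2)+81m(i-1,j-3)-12m(i-2,j-1)+9m(i-2,j-2)+m(i-3,j-1)$. Then for all $i,j\ge1$, $$\pi(a(i,j))\ge\left\lfloor\frac{3j-i-1}{2}\right\rfloor,\qquad \pi(b(i,j))\ge\left\lfloor\frac{3j-i}{2}\right\rfloor.$$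
   Context: $\pi(n)$ denotes the $3$-adic order of an integer $n$, with $\pi(0)=\infty$; $\lfloor x\rfloor$ is the largest integer not exceeding $x$. -}

module Defs where

open import Data.Nat as ℕ using (ℕ; zero; suc)
open import Data.Integer using (ℤ; +_; -[1+_]; _+_; _-_; _*_; -_; _/ℕ_)
open import Data.Integer.Divisibility using (_∣_)
open import Data.Unit using (⊤)
open import Data.List using (List; []; _∷_)

-- Integer matrices indexed by naturals; index 0 stands for every index ≤ 0
-- (all such entries are 0).  Entry (i , j) with i , j ≥ 1 is the paper's m(i,j).
Mat : Set
Mat = ℕ → ℕ → ℤ

row : List ℤ → ℕ → ℤ
row xs       zero          = + 0
row []       (suc j)       = + 0
row (x ∷ xs) (suc zero)    = x
row (x ∷ xs) (suc (suc j)) = row xs (suc j)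

-- entry m(i , j - k), equal to 0 when j - k ≤ 0
shift : (ℕ → ℤ) → ℕ → ℕ → ℤ
shift f zero    k       = + 0
shift f (suc j) zero    = f (suc j)
shift f (suc j) (suc k) = shift f j k

recMat : List ℤ → List ℤ → List ℤ → Mat
recMat r1 r2 r3 zero                      j = + 0
recMat r1 r2 r3 (suc zero)                j = row r1 j
recMat r1 r2 r3 (suc (suc zero))          j = row r2 j
recMat r1 r2 r3 (suc (suc (suc zero)))    j = row r3 j
recMat r1 r2 r3 (suc (suc (suc (suc n)))) j =
    + 30  * shift (recMat r1 r2 r3 (suc (suc (suc n)))) j 1
  - + 108 * shift (recMat r1 r2 r3 (suc (suc (suc n)))) j 2
  + + 81  * shift (recMat r1 r2 r3 (suc (suc (suc n)))) j 3
  - + 12  * shift (recMat r1 r2 r3 (suc (suc n))) j 1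
  + + 9   * shift (recMat r1 r2 r3 (suc (suc n))) j 2
  +         shift (recMat r1 r2 r3 (suc n)) j 1

a : Mat
a = recMat
  (+ 10 ∷ - + 36 ∷ + 27 ∷ [])
  (- + 8 ∷ + 306 ∷ - + 2160 ∷ + 5508 ∷ - + 5832 ∷ + 2187 ∷ [])
  (+ 1 ∷ - + 360 ∷ + 10566 ∷ - + 99144 ∷ + 423549 ∷ - + 944784 ∷ + 1141614 ∷ - + 708588 ∷ + 177147 ∷ [])

b : Mat
b = recMat
  (- + 9 ∷ + 252 ∷ - + 891 ∷ + 729 ∷ [])
  (+ 1 ∷ - + 378 ∷ + 8613 ∷ - + 54675 ∷ + 138510 ∷ - + 150903 ∷ + 59049 ∷ [])
  (+ 0 ∷ + 147 ∷ - + 14553 ∷ + 312255 ∷ - + 2617839 ∷ + 10764414 ∷ - + 23914845 ∷ + 29288304 ∷ - + 18600435 ∷ + 4782969 ∷ [])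

-- π(n) ≥ k, where π is the 3-adic order (π(0) = ∞): trivially true for k < 0,
-- and for k ≥ 0 it says 3^k divides n.
_π≥_ : ℤ → ℤ → Set
n π≥ (+ k)    = + (3 ℕ.^ k) ∣ n
n π≥ -[1+ k ] = ⊤

⌊_/2⌋ : ℤ → ℤ
⌊ x /2⌋ = x /ℕ 2

module Submission where

-- Call an integer row f "bounded with offset s"
-- when 3^k divides f j whenever s + 2k ≤ 3j, i.e. π(f j) ≥ ⌊(3j − s)/2⌋; call a
-- matrix m "bounded with offset e" when every row n is bounded with offset n + e.
-- The theorem says a is bounded with offset 1 and b with offset 0.
--
-- Row bounds are stable under the operations building the recurrence:
--   * shifting a row d columns to the right adds 3d to the offset;
--   * multiplying by an integer divisible by 3^c lowers the offset by 2c;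
--   * sums and differences keep a common offset, and offsets may be raised.
-- Each of the six recurrence terms m(i−r', j−d) with coefficient divisible by
-- 3^c satisfies 3d ≤ 2c + r', so row i inherits the bound from rows i−1,i−2,i−3
-- (strong induction on the row index, built into the recursion of recMat).
-- Rows 1–3 are finite lists whose bounds are checked by evaluation.

open import Defs
open import Data.Nat using (ℕ; suc)
open import Data.Integer using (+_; _-_; _*_)
open import Data.Product using (_×_)

open import Data.Nat as ℕ using (zero; _≤_; _∸_; _^_)
open import Data.Nat.Properties as ℕ using (≤-total; m≤n⇒∃[o]m+o≡n)
open import Data.Nat.DivMod using (_/_; m*n/n≡m; /-monoˡ-≤)
open import Data.Nat.Tactic.RingSolver as ℕ-Solver using ()
open import Data.Integer as ℤ using (ℤ; -[1+_]; _/ℕ_)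
open import Data.Integer.Properties as ℤ using (pos-+; pos-*; drop‿+≤+)
open import Data.Integer.DivMod using ([n/ℕd]*d≤n)
open import Data.Integer.Divisibility.Signed
  using (_∣_; divides; _∣?_; ∣-trans; ∣⇒∣ᵤ; *-monoˡ-∣; *-monoʳ-∣; ∣m⇒∣m*n; ∣m∣n⇒∣m+n; ∣m∣n⇒∣m-n)
open import Data.Integer.Tactic.RingSolver as ℤ-Solver using ()
open import Data.List using (List; []; _∷_)
open import Data.Product using (_,_)
open import Data.Sum using (inj₁; inj₂)
open import Data.Unit using (⊤; tt)
open import Relation.Nullary.Decidable using (True; toWitness)
open import Relation.Binary.PropositionalEquality using (_≡_; refl; sym; trans; cong; subst)

pow3 : ℕ → ℤ
pow3 k = + (3 ^ k)

pow3-+ : ∀ c k → pow3 (c ℕ.+ k) ≡ pow3 c * pow3 k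
pow3-+ c k = trans (cong +_ (ℕ.^-distribˡ-+-* 3 c k)) (pos-* (3 ^ c) (3 ^ k))

pow3-mono : ∀ {k K} → k ≤ K → pow3 k ∣ pow3 K
pow3-mono {k} k≤K with m≤n⇒∃[o]m+o≡n k≤K
... | k' , refl = divides (pow3 k') (trans (pow3-+ k k') (ℤ.*-comm (pow3 k) (pow3 k')))

pow3∣0 : ∀ k → pow3 k ∣ + 0
pow3∣0 k = divides (+ 0) refl

*-pres-∣ : ∀ {p q x y} → p ∣ x → q ∣ y → p * q ∣ x * y
*-pres-∣ {q = q} {x = x} p∣x q∣y = ∣-trans (*-monoˡ-∣ q p∣x) (*-monoʳ-∣ x q∣y)

RowBound : ℕ → (ℕ → ℤ) → Set
RowBound s f = ∀ j k → s ℕ.+ k ℕ.* 2 ≤ j ℕ.* 3 → pow3 k ∣ f j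

MatrixBound : ℕ → Mat → Set
MatrixBound e m = ∀ n → RowBound (n ℕ.+ e) (m n)

weaken : ∀ {s s' f} → s ≤ s' → RowBound s f → RowBound s' f
weaken s≤s' hf j k h = hf j k (ℕ.≤-trans (ℕ.+-monoˡ-≤ (k ℕ.* 2) s≤s') h)

shift-bound : ∀ {s f} d → RowBound s f → RowBound (d ℕ.* 3 ℕ.+ s) (λ j → shift f j d)
shift-bound d       hf zero    k h = pow3∣0 k
shift-bound zero    hf (suc j) k h = hf (suc j) k h
shift-bound (suc d) hf (suc j) k (ℕ.s≤s (ℕ.s≤s (ℕ.s≤s h))) = shift-bound d hf j k h

scale-bound : ∀ {x s f} c → pow3 c ∣ x → RowBound (c ℕ.* 2 ℕ.+ s) f →
  RowBound s (λ j → x * f j)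
scale-bound {x} {s} {f} c hx hf j k h with ≤-total k c
... | inj₁ k≤c = ∣m⇒∣m*n (f j) (∣-trans (pow3-mono k≤c) hx)
... | inj₂ c≤k with m≤n⇒∃[o]m+o≡n c≤k
...   | k' , refl =
  subst (_∣ x * f j) (sym (pow3-+ c k'))
    (*-pres-∣ hx (hf j k' (subst (ℕ._≤ j ℕ.* 3) (regroup c s k') h)))
  where
  regroup : ∀ c s k' → s ℕ.+ (c ℕ.+ k') ℕ.* 2 ≡ c ℕ.* 2 ℕ.+ s ℕ.+ k' ℕ.* 2
  regroup = ℕ-Solver.solve-∀

term-bound : ∀ {r q d N f} x c → pow3 c ∣ x → d ℕ.* 3 ℕ.+ r ≤ c ℕ.* 2 ℕ.+ q →
  RowBound (r ℕ.+ N) f → RowBound (q ℕ.+ N) (λ j → x * shift f j d)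
term-bound {r} {q} {d} {N} x c hx ineq hf =
  scale-bound c hx (weaken offsets (shift-bound d hf))
  where
  open ℕ.≤-Reasoning
  offsets : d ℕ.* 3 ℕ.+ (r ℕ.+ N) ≤ c ℕ.* 2 ℕ.+ (q ℕ.+ N)
  offsets = begin
    d ℕ.* 3 ℕ.+ (r ℕ.+ N)   ≡⟨ sym (ℕ.+-assoc (d ℕ.* 3) r N) ⟩
    d ℕ.* 3 ℕ.+ r ℕ.+ N     ≤⟨ ℕ.+-monoˡ-≤ N ineq ⟩
    c ℕ.* 2 ℕ.+ q ℕ.+ N     ≡⟨ ℕ.+-assoc (c ℕ.* 2) q N ⟩
    c ℕ.* 2 ℕ.+ (q ℕ.+ N)   ∎

max-exponent : ∀ {s k m} → s ℕ.+ k ℕ.* 2 ≤ m → k ≤ (m ∸ s) / 2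
max-exponent {s} {k} {m} h = subst (_≤ (m ∸ s) / 2) (m*n/n≡m k 2)
  (/-monoˡ-≤ 2 (ℕ.m+n≤o⇒m≤o∸n (k ℕ.* 2) (subst (_≤ m) (ℕ.+-comm s (k ℕ.* 2)) h)))

ListBound : ℕ → ℕ → List ℤ → Set
ListBound s j₀ []       = ⊤
ListBound s j₀ (x ∷ xs) = True (pow3 ((j₀ ℕ.* 3 ∸ s) / 2) ∣? x) × ListBound s (suc j₀) xs

list-bound : ∀ {s} j₀ xs → ListBound s j₀ xs →
  ∀ t k → s ℕ.+ k ℕ.* 2 ≤ (j₀ ℕ.+ t) ℕ.* 3 → pow3 k ∣ row xs (suc t)
list-bound {s} j₀ []       _        t       k h = pow3∣0 k
list-bound {s} j₀ (x ∷ xs) (hx , _) zero    k h =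
  ∣-trans (pow3-mono (max-exponent {s} {k} column-j₀)) (toWitness hx)
  where
  column-j₀ : s ℕ.+ k ℕ.* 2 ≤ j₀ ℕ.* 3
  column-j₀ = subst (λ j → s ℕ.+ k ℕ.* 2 ≤ j ℕ.* 3) (ℕ.+-identityʳ j₀) h
list-bound {s} j₀ (x ∷ xs) (_ , hs) (suc t) k h =
  list-bound (suc j₀) xs hs t k (subst (λ j → s ℕ.+ k ℕ.* 2 ≤ j ℕ.* 3) (ℕ.+-suc j₀ t) h)

row-bound : ∀ {s} xs → ListBound s 1 xs → RowBound s (row xs)
row-bound xs hs zero    k h = pow3∣0 k
row-bound xs hs (suc t) k h = list-bound 1 xs hs t k h

-- In row n + 4 (offset 4 + N, N = n + e) the term x · m(n + r, j − d) with
-- 3^c ∣ x is controlled by term-bound, since 3d + r ≤ 2c + 4 in all six cases.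
recMat-bound : ∀ e r₁ r₂ r₃ → ListBound (1 ℕ.+ e) 1 r₁ → ListBound (2 ℕ.+ e) 1 r₂ →
  ListBound (3 ℕ.+ e) 1 r₃ → MatrixBound e (recMat r₁ r₂ r₃)
recMat-bound e r₁ r₂ r₃ h₁ h₂ h₃ = bound
  where
  bound : MatrixBound e (recMat r₁ r₂ r₃)
  bound zero                      j k h = pow3∣0 k
  bound (suc zero)                      = row-bound r₁ h₁
  bound (suc (suc zero))                = row-bound r₂ h₂
  bound (suc (suc (suc zero)))          = row-bound r₃ h₃
  bound (suc (suc (suc (suc n)))) j k h =
    ∣m∣n⇒∣m+n (∣m∣n⇒∣m+n (∣m∣n⇒∣m-n (∣m∣n⇒∣m+n (∣m∣n⇒∣m-n
      (term (+ 30)  1 1 3 (divides (+ 10) refl) _ (bound (suc (suc (suc n)))) j k h)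
      (term (+ 108) 3 2 3 (divides (+ 4)  refl) _ (bound (suc (suc (suc n)))) j k h))
      (term (+ 81)  4 3 3 (divides (+ 1)  refl) _ (bound (suc (suc (suc n)))) j k h))
      (term (+ 12)  1 1 2 (divides (+ 4)  refl) _ (bound (suc (suc n))) j k h))
      (term (+ 9)   2 2 2 (divides (+ 1)  refl) _ (bound (suc (suc n))) j k h))
      (shift-bound 1 (bound (suc n)) j k h)
    where
    -- coefficient x with 3^c ∣ x, shift d, source row n + r
    term : ∀ {f} x c d r → pow3 c ∣ x → True (d ℕ.* 3 ℕ.+ r ℕ.≤? c ℕ.* 2 ℕ.+ 4) →
      RowBound (r ℕ.+ (n ℕ.+ e)) f → RowBound (4 ℕ.+ (n ℕ.+ e)) (λ j → x * shift f j d)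
    term x c d r hx ineq = term-bound x c hx (toWitness ineq)

-- From an offset bound to the floor form of the statement: if x + s = 3J and
-- K = ⌊x/2⌋ ≥ 0 then s + 2K ≤ 3J (a negative floor makes the claim trivial).
π≥-floor : ∀ v x s J → x ℤ.+ + s ≡ + J * + 3 →
  (∀ k → s ℕ.+ k ℕ.* 2 ≤ J ℕ.* 3 → pow3 k ∣ v) → v π≥ ⌊ x /2⌋
π≥-floor v x s J ex hv with x /ℕ 2 | [n/ℕd]*d≤n x 2
... | -[1+ _ ] | _    = tt
... | + K      | K*2≤x = ∣⇒∣ᵤ (hv K (drop‿+≤+ exponent-fits))
  where
  open ℤ.≤-Reasoning
  exponent-fits : + (s ℕ.+ K ℕ.* 2) ℤ.≤ + (J ℕ.* 3)
  exponent-fits = begin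
    + (s ℕ.+ K ℕ.* 2)       ≡⟨ trans (pos-+ s (K ℕ.* 2)) (cong (ℤ._+_ (+ s)) (pos-* K 2)) ⟩
    + s ℤ.+ + K * + 2       ≤⟨ ℤ.+-monoʳ-≤ (+ s) K*2≤x ⟩
    + s ℤ.+ x               ≡⟨ ℤ.+-comm (+ s) x ⟩
    x ℤ.+ + s               ≡⟨ ex ⟩
    + J * + 3               ≡⟨ sym (pos-* J 3) ⟩
    + (J ℕ.* 3)             ∎

matrix-π≥ : ∀ {e m} → MatrixBound e m → ∀ n J x → x ℤ.+ (+ n ℤ.+ + e) ≡ + J * + 3 →
  m n J π≥ ⌊ x /2⌋
matrix-π≥ {e} {m} hm n J x ex =
  π≥-floor (m n J) x (n ℕ.+ e) J (trans (cong (ℤ._+_ x) (pos-+ n e)) ex) (hm n J)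

-- The initial rows of a and b are certified by evaluation.
a-bound : MatrixBound 1 a
a-bound = recMat-bound 1 _ _ _ _ _ _

b-bound : MatrixBound 0 b
b-bound = recMat-bound 0 _ _ _ _ _ _

theorem3p1 : (i j : ℕ) →
    (a (suc i) (suc j) π≥ ⌊ + 3 * + suc j - + suc i - + 1 /2⌋)
    × (b (suc i) (suc j) π≥ ⌊ + 3 * + suc j - + suc i /2⌋)
theorem3p1 i j =
    matrix-π≥ a-bound (suc i) (suc j) (+ 3 * + suc j - + suc i - + 1) (offset-a (+ suc j) (+ suc i))
  , matrix-π≥ b-bound (suc i) (suc j) (+ 3 * + suc j - + suc i) (offset-b (+ suc j) (+ suc i))
  where
  offset-a : ∀ J n → + 3 * J - n - + 1 ℤ.+ (n ℤ.+ + 1) ≡ J * + 3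
  offset-a = ℤ-Solver.solve-∀
  offset-b : ∀ J n → + 3 * J - n ℤ.+ (n ℤ.+ + 0) ≡ J * + 3
  offset-b = ℤ-Solver.solve-∀
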